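{- Let $a,b,p,q$ be complex numbers with $p\neq 0$, $q\neq 0$, and let $(W_j)$, $(U_j)$ be as defined in the context. If $m$ and $n$ are non-negative integers and $r,s,t$ are any integers, then \[ \sum_{k = 0}^n ( - q^s)^k \binom{m - n + k}{k} U_r^k U_s^{n - k} W_{r(n - k) - sk + t} = \sum_{k = 0}^n ( - q^s)^k \binom{m + 1}{k} U_r^k U_{r + s}^{n - k} W_{t - sk}. \]
   Context: The Horadam sequence $W_j=W_j(a,b;p,q)$ is defined by $W_0=a$, $W_1=b$, $W_j=pW_{j-1}-qW_{j-2}$ for $j\ge 2$, and extended to negative indices by $W_{ -j}=\frac{1}{q}(pW_{ -j+1}-W_{ -j+2})$. The Lucas sequence of the first kind is $U_j=W_j(0,1;p,q)$. For a complex number $x$ and a non-negative integer $k$, $\binom{x}{k}=x(x-1)\cdots(x-k+1)/k!$ (so the upper index may be negative). -}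

module Defs where

open import Level using (Level)
open import Algebra.Bundles using (CommutativeRing)
open import Data.Nat as ℕ using (ℕ; zero; suc; _!)
open import Data.Nat.Properties using (_!≢0)

open import Data.Integer as ℤ using (ℤ; +_; -[1+_]; _/ℕ_)
open import Data.Product using (_×_; _,_; proj₁)

-- Generalized binomial coefficient with integer upper index:
-- binom x k = x (x-1) ... (x-k+1) / k!   (an exact integer division)
fallingℤ : ℤ → ℕ → ℤ
fallingℤ x zero    = + 1
fallingℤ x (suc k) = fallingℤ x k ℤ.* (x ℤ.- + k)

binom : ℤ → ℕ → ℤ
binom x k = _/ℕ_ (fallingℤ x k) (k !) {{k !≢0}}

module Horadam {c ℓ : Level} (R : CommutativeRing c ℓ) where
  open CommutativeRing R hiding (zero)

  infixr 8 _^_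
  _^_ : Carrier → ℕ → Carrier
  x ^ zero  = 1#
  x ^ suc n = x * (x ^ n)

  _·_ : ℕ → Carrier → Carrier
  zero  · x = 0#
  suc n · x = x + (n · x)

  fromℤ : ℤ → Carrier
  fromℤ (+ n)     = n · 1#
  fromℤ -[1+ n ]  = - (suc n · 1#)

  -- q^s for an integer exponent s, where qinv is the inverse of q
  zpow : (q qinv : Carrier) → ℤ → Carrier
  zpow q qinv (+ n)    = q ^ n
  zpow q qinv -[1+ n ] = qinv ^ suc n

  sumTo : ℕ → (ℕ → Carrier) → Carrier
  sumTo zero    f = f zero
  sumTo (suc n) f = sumTo n f + f (suc n)

  module _ (a b p q qinv : Carrier) where
    -- (W_n , W_{n+1}) for n ≥ 0
    Wpos : ℕ → Carrier × Carrier
    Wpos zero    = a , b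
    Wpos (suc n) with Wpos n
    ... | x , y = y , (p * y - q * x)

    -- (W_{-n} , W_{-n+1}) for n ≥ 0, using W_{-j} = q⁻¹ (p W_{-j+1} - W_{-j+2})
    Wneg : ℕ → Carrier × Carrier
    Wneg zero    = a , b
    Wneg (suc n) with Wneg n
    ... | x , y = qinv * (p * x - y) , x

    W : ℤ → Carrier
    W (+ n)      = proj₁ (Wpos n)
    W -[1+ n ]   = proj₁ (Wneg (suc n))

  U : (p q qinv : Carrier) → ℤ → Carrier
  U p q qinv = W 0# 1# p q qinv

{-# OPTIONS --safe #-}
module Submission where

-- Let m range over ℤ and write L(m, n, t), R(m, n, t) for the two sides (the right one with
-- binom (m + 1) k). Pascal's rule for the generalised binomial coefficient gives both sides the
-- recurrence L(m + 1, n + 1, t) = L(m, n + 1, t) - q^s U_r L(m, n, t - s), so by induction on m it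
-- suffices that L(-1, n, t) = R(-1, n, t) = U_{r+s}^n W_t. On the right only the term k = 0
-- survives. On the left, binom 0 (n + 1) = 0 gives L(0, n + 1, t) = U_s L(-1, n, t + r), and with
-- the recurrence an induction on n reduces the claim to the addition formula
--   U_{r+s} W_t = U_s W_{t+r} + q^s W_{t-s} U_r.
-- Both of its sides satisfy the Horadam recurrence in s and agree at s = 0 and s = 1 (the case
-- s = 1 is the same argument in r), so they agree for all s ∈ ℤ; running the recurrence towards
-- negative indices is where the inverse of q is used.

open import Defs
open import Level using (Level)
open import Algebra.Bundles using (CommutativeRing)
open import Data.Nat using (ℕ)
open import Data.Nat as ℕ using (zero; suc; _!; _∸_)
import Data.Nat.Properties as ℕ
open import Data.Nat.Properties using (_!≢0)
import Data.Nat.DivMod as ℕ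
open import Data.Integer as ℤ using (ℤ; +_; -[1+_])
import Data.Integer.Properties as ℤ
open import Data.Integer.Tactic.RingSolver using (solve-∀)
open import Data.Product using (_,_; _×_; proj₁; proj₂)
open import Relation.Binary.PropositionalEquality as ≡ using (_≡_)
open import Relation.Nullary using (¬_)

module GeneralisedBinomial where
  open import Data.Integer using (_/ℕ_; _+_; _-_; _*_)
  open import Data.Integer.Divisibility.Signed using (_∣_; divides; ∣-refl; ∣m∣n⇒∣m+n; ∣m+n∣n⇒∣m; *-monoʳ-∣)
  open ≡ using (refl; sym; trans; cong; cong₂; subst)
  open ≡.≡-Reasoning

  ℤ-induction : ∀ {p} (P : ℤ → Set p) → P (+ 0) →
                (∀ x → P x → P (+ 1 + x)) → (∀ x → P (+ 1 + x) → P x) → ∀ x → P x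
  ℤ-induction P p₀ up down (+ zero)     = p₀
  ℤ-induction P p₀ up down (+ suc n)    = up (+ n) (ℤ-induction P p₀ up down (+ n))
  ℤ-induction P p₀ up down -[1+ zero ]  = down -[1+ zero ] p₀
  ℤ-induction P p₀ up down -[1+ suc n ] = down -[1+ suc n ] (ℤ-induction P p₀ up down -[1+ n ])

  /ℕ-exact : ∀ c d .{{_ : ℕ.NonZero d}} → (c * + d) /ℕ d ≡ c
  /ℕ-exact (+ m) d@(suc _) rewrite sym (ℤ.pos-* m d) = cong +_ (ℕ.m*n/n≡m m d)
  /ℕ-exact -[1+ m ] d@(suc _) with suc m ℕ.* d ℕ.% d | ℕ.m*n%n≡0 (suc m) d
  ... | zero  | _  = cong (λ z → ℤ.- (+ z)) (ℕ.m*n/n≡m (suc m) d)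
  ... | suc _ | ()

  falling-suc-upper : ∀ x k → fallingℤ (+ 1 + x) (suc k) ≡ (+ 1 + x) * fallingℤ x k
  falling-suc-upper x zero    = base (+ 1 + x)
    where
    base : ∀ y → + 1 * (y - + 0) ≡ y * + 1
    base = solve-∀
  falling-suc-upper x (suc k) = begin
    fallingℤ (+ 1 + x) (suc k) * ((+ 1 + x) - + suc k)   ≡⟨ cong (_* ((+ 1 + x) - + suc k)) (falling-suc-upper x k) ⟩
    (+ 1 + x) * fallingℤ x k * ((+ 1 + x) - (+ 1 + + k)) ≡⟨ shift x (fallingℤ x k) (+ k) ⟩
    (+ 1 + x) * (fallingℤ x k * (x - + k))               ∎
    where
    shift : ∀ x f k → (+ 1 + x) * f * ((+ 1 + x) - (+ 1 + k)) ≡ (+ 1 + x) * (f * (x - k))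
    shift = solve-∀

  falling-pascal : ∀ x k → fallingℤ (+ 1 + x) (suc k) ≡ fallingℤ x (suc k) + + suc k * fallingℤ x k
  falling-pascal x k = trans (falling-suc-upper x k) (split x (fallingℤ x k) (+ k))
    where
    split : ∀ x f k → (+ 1 + x) * f ≡ f * (x - k) + (+ 1 + k) * f
    split = solve-∀

  falling-zero : ∀ k → fallingℤ (+ 0) (suc k) ≡ + 0
  falling-zero zero    = refl
  falling-zero (suc k) = cong (_* (+ 0 - + suc k)) (falling-zero k)

  factorial-∣-falling : ∀ k x → + (k !) ∣ fallingℤ x k
  factorial-∣-falling zero    x = ∣-refl
  factorial-∣-falling (suc k) = ℤ-induction P (divides (+ 0) (falling-zero k)) up down
    where
    P : ℤ → Set
    P x = + (suc k !) ∣ fallingℤ x (suc k)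
    ∣-lower-term : ∀ x → + (suc k !) ∣ + suc k * fallingℤ x k
    ∣-lower-term x = subst (_∣ + suc k * fallingℤ x k) (sym (ℤ.pos-* (suc k) (k !)))
                           (*-monoʳ-∣ (+ suc k) (factorial-∣-falling k x))
    up : ∀ x → P x → P (+ 1 + x)
    up x ∣x = subst (+ (suc k !) ∣_) (sym (falling-pascal x k)) (∣m∣n⇒∣m+n ∣x (∣-lower-term x))
    down : ∀ x → P (+ 1 + x) → P x
    down x ∣1+x = ∣m+n∣n⇒∣m (subst (+ (suc k !) ∣_) (falling-pascal x k) ∣1+x) (∣-lower-term x)

  binom*k!≡falling : ∀ x k → binom x k * + (k !) ≡ fallingℤ x k
  binom*k!≡falling x k with factorial-∣-falling k x
  ... | divides c eq = begin
    binom x k * + (k !)                        ≡⟨ cong (λ y → (y /ℕ k !) {{k !≢0}} * + (k !)) eq ⟩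
    ((c * + (k !)) /ℕ k !) {{k !≢0}} * + (k !) ≡⟨ cong (_* + (k !)) (/ℕ-exact c (k !) {{k !≢0}}) ⟩
    c * + (k !)                                ≡⟨ eq ⟨
    fallingℤ x k                               ∎

  binom-pascal : ∀ x k → binom (+ 1 + x) (suc k) ≡ binom x (suc k) + binom x k
  binom-pascal x k = ℤ.*-cancelʳ-≡ _ _ (+ (suc k !)) {{suc k !≢0}} (begin
    binom (+ 1 + x) (suc k) * + (suc k !)    ≡⟨ binom*k!≡falling (+ 1 + x) (suc k) ⟩
    fallingℤ (+ 1 + x) (suc k)               ≡⟨ falling-pascal x k ⟩
    fallingℤ x (suc k) + + suc k * fallingℤ x k
      ≡⟨ cong₂ (λ u v → u + + suc k * v) (binom*k!≡falling x (suc k)) (binom*k!≡falling x k) ⟨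
    b₁ * + (suc k !) + + suc k * (b₀ * + (k !))
      ≡⟨ cong (λ f → b₁ * f + + suc k * (b₀ * + (k !))) (ℤ.pos-* (suc k) (k !)) ⟩
    b₁ * (+ suc k * + (k !)) + + suc k * (b₀ * + (k !))
      ≡⟨ collect b₁ b₀ (+ suc k) (+ (k !)) ⟩
    (b₁ + b₀) * (+ suc k * + (k !))          ≡⟨ cong ((b₁ + b₀) *_) (ℤ.pos-* (suc k) (k !)) ⟨
    (b₁ + b₀) * + (suc k !)                  ∎)
    where
    b₁ = binom x (suc k)
    b₀ = binom x k
    collect : ∀ b b′ n f → b * (n * f) + n * (b′ * f) ≡ (b + b′) * (n * f)
    collect = solve-∀

  binom-zero : ∀ k → binom (+ 0) (suc k) ≡ + 0
  binom-zero k = ℤ.*-cancelʳ-≡ _ _ (+ (suc k !)) {{suc k !≢0}}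
    (trans (binom*k!≡falling (+ 0) (suc k)) (falling-zero k))

open GeneralisedBinomial using (ℤ-induction; binom-pascal; binom-zero)

module HoradamIdentities {c ℓ : Level} (R : CommutativeRing c ℓ) where
  open CommutativeRing R hiding (zero)
  open Horadam R
  open import Algebra.Properties.Ring ring using (-‿distribˡ-*)
  open import Algebra.Properties.AbelianGroup +-abelianGroup
    using (⁻¹-∙-comm; ⁻¹-involutive; ε⁻¹≈ε; \\-leftDividesˡ; //-rightDividesˡ; //-rightDividesʳ; ∙-cancelˡ)
  open import Algebra.Solver.Ring.NaturalCoefficients.Default commutativeSemiring
    using (solve; _:+_; _:*_; _:=_; con)
  open import Relation.Binary.Reasoning.Setoid setoid

  reflexive-cong : ∀ {a} {A : Set a} (f : A → Carrier) {x y} → x ≡ y → f x ≈ f y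
  reflexive-cong f eq = reflexive (≡.cong f eq)

  fromℤ-suc : ∀ i → fromℤ (+ 1 ℤ.+ i) ≈ 1# + fromℤ i
  fromℤ-suc (+ n)          = refl
  fromℤ-suc -[1+ zero ]    = sym (trans (+-congˡ (-‿cong (+-identityʳ 1#))) (-‿inverseʳ 1#))
  fromℤ-suc -[1+ suc n ]   = begin
    - (suc n · 1#)               ≈⟨ \\-leftDividesˡ 1# (- (suc n · 1#)) ⟨
    1# + (- 1# + - (suc n · 1#)) ≈⟨ +-congˡ (⁻¹-∙-comm 1# (suc n · 1#)) ⟩
    1# + - (suc (suc n) · 1#)    ∎

  fromℤ-+ : ∀ x y → fromℤ (x ℤ.+ y) ≈ fromℤ x + fromℤ y
  fromℤ-+ = ℤ-induction P base up down
    where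
    P : ℤ → Set ℓ
    P x = ∀ y → fromℤ (x ℤ.+ y) ≈ fromℤ x + fromℤ y
    base : P (+ 0)
    base y = trans (reflexive-cong fromℤ (ℤ.+-identityˡ y)) (sym (+-identityˡ (fromℤ y)))
    shifted : ∀ x y → P x → fromℤ ((+ 1 ℤ.+ x) ℤ.+ y) ≈ 1# + (fromℤ x + fromℤ y)
    shifted x y ih = begin
      fromℤ ((+ 1 ℤ.+ x) ℤ.+ y) ≡⟨ ≡.cong fromℤ (ℤ.+-assoc (+ 1) x y) ⟩
      fromℤ (+ 1 ℤ.+ (x ℤ.+ y)) ≈⟨ fromℤ-suc (x ℤ.+ y) ⟩
      1# + fromℤ (x ℤ.+ y)      ≈⟨ +-congˡ (ih y) ⟩
      1# + (fromℤ x + fromℤ y)  ∎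
    up : ∀ x → P x → P (+ 1 ℤ.+ x)
    up x ih y = begin
      fromℤ ((+ 1 ℤ.+ x) ℤ.+ y) ≈⟨ shifted x y ih ⟩
      1# + (fromℤ x + fromℤ y)  ≈⟨ +-assoc 1# (fromℤ x) (fromℤ y) ⟨
      (1# + fromℤ x) + fromℤ y  ≈⟨ +-congʳ (fromℤ-suc x) ⟨
      fromℤ (+ 1 ℤ.+ x) + fromℤ y ∎
    down : ∀ x → P (+ 1 ℤ.+ x) → P x
    down x ih y = ∙-cancelˡ 1# _ _ (begin
      1# + fromℤ (x ℤ.+ y)        ≈⟨ fromℤ-suc (x ℤ.+ y) ⟨
      fromℤ (+ 1 ℤ.+ (x ℤ.+ y))   ≡⟨ ≡.cong fromℤ (ℤ.+-assoc (+ 1) x y) ⟨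
      fromℤ ((+ 1 ℤ.+ x) ℤ.+ y)   ≈⟨ ih y ⟩
      fromℤ (+ 1 ℤ.+ x) + fromℤ y ≈⟨ +-congʳ (fromℤ-suc x) ⟩
      (1# + fromℤ x) + fromℤ y    ≈⟨ +-assoc 1# (fromℤ x) (fromℤ y) ⟩
      1# + (fromℤ x + fromℤ y)    ∎)

  sumTo-cong : ∀ n {f g : ℕ → Carrier} → (∀ k → k ℕ.≤ n → f k ≈ g k) → sumTo n f ≈ sumTo n g
  sumTo-cong zero    f≈g = f≈g 0 ℕ.z≤n
  sumTo-cong (suc n) f≈g = +-cong (sumTo-cong n (λ k k≤n → f≈g k (ℕ.m≤n⇒m≤1+n k≤n))) (f≈g (suc n) ℕ.≤-refl)

  sumTo-+ : ∀ n (f g : ℕ → Carrier) → sumTo n (λ k → f k + g k) ≈ sumTo n f + sumTo n g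
  sumTo-+ zero    f g = refl
  sumTo-+ (suc n) f g = trans (+-congʳ (sumTo-+ n f g)) (interchange _ _ _ _)
    where
    interchange : ∀ a b c d → (a + b) + (c + d) ≈ (a + c) + (b + d)
    interchange = solve 4 (λ a b c d → (a :+ b) :+ (c :+ d) := (a :+ c) :+ (b :+ d)) refl

  sumTo-*ˡ : ∀ n (d : Carrier) (f : ℕ → Carrier) → sumTo n (λ k → d * f k) ≈ d * sumTo n f
  sumTo-*ˡ zero    d f = refl
  sumTo-*ˡ (suc n) d f = trans (+-congʳ (sumTo-*ˡ n d f)) (sym (distribˡ d _ _))

  sumTo-suc : ∀ n (f : ℕ → Carrier) → sumTo (suc n) f ≈ f 0 + sumTo n (λ k → f (suc k))
  sumTo-suc zero    f = refl
  sumTo-suc (suc n) f = trans (+-congʳ (sumTo-suc n f)) (+-assoc _ _ _)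

  sumTo≈head : ∀ n {f : ℕ → Carrier} → (∀ k → f (suc k) ≈ 0#) → sumTo n f ≈ f 0
  sumTo≈head zero    f₊≈0 = refl
  sumTo≈head (suc n) f₊≈0 = trans (+-cong (sumTo≈head n f₊≈0) (f₊≈0 n)) (+-identityʳ _)

  module Recurrence (p q qinv : Carrier) (q*qinv≈1 : q * qinv ≈ 1#) where

    -- Shifts are written + k ℤ.+ j so that they compute on j = + n.
    Recurrent : (ℤ → Carrier) → Set ℓ
    Recurrent f = ∀ j → f (+ 2 ℤ.+ j) + q * f j ≈ p * f (+ 1 ℤ.+ j)

    q*[qinv*x]≈x : ∀ x → q * (qinv * x) ≈ x
    q*[qinv*x]≈x x = trans (sym (*-assoc q qinv x)) (trans (*-congʳ q*qinv≈1) (*-identityˡ x))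

    qinv*[q*x]≈x : ∀ x → qinv * (q * x) ≈ x
    qinv*[q*x]≈x x = trans (*-congˡ (*-comm q x)) (trans (sym (*-assoc qinv x q)) (trans (*-comm _ q) (q*[qinv*x]≈x x)))

    recurrent-forward : ∀ {f} → Recurrent f → ∀ j → f (+ 2 ℤ.+ j) ≈ p * f (+ 1 ℤ.+ j) - q * f j
    recurrent-forward {f} rec j = trans (sym (//-rightDividesʳ (q * f j) (f (+ 2 ℤ.+ j)))) (+-congʳ (rec j))

    recurrent-backward : ∀ {f} → Recurrent f → ∀ j → f j ≈ qinv * (p * f (+ 1 ℤ.+ j) - f (+ 2 ℤ.+ j))
    recurrent-backward {f} rec j = begin
      f j                                                ≈⟨ qinv*[q*x]≈x (f j) ⟨
      qinv * (q * f j)                                   ≈⟨ *-congˡ (//-rightDividesʳ (f (+ 2 ℤ.+ j)) (q * f j)) ⟨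
      qinv * ((q * f j + f (+ 2 ℤ.+ j)) - f (+ 2 ℤ.+ j)) ≈⟨ *-congˡ (+-congʳ (trans (+-comm _ _) (rec j))) ⟩
      qinv * (p * f (+ 1 ℤ.+ j) - f (+ 2 ℤ.+ j))         ∎

    recurrent-unique : ∀ {f g} → Recurrent f → Recurrent g →
                       f (+ 0) ≈ g (+ 0) → f (+ 1) ≈ g (+ 1) → ∀ j → f j ≈ g j
    recurrent-unique {f} {g} rec-f rec-g f0≈g0 f1≈g1 = agree
      where
      ahead : ∀ n → f (+ n) ≈ g (+ n) × f (+ suc n) ≈ g (+ suc n)
      ahead zero    = f0≈g0 , f1≈g1
      ahead (suc n) with ahead n
      ... | fn≈gn , fn+1≈gn+1 = fn+1≈gn+1 , (begin
        f (+ 2 ℤ.+ + n)                   ≈⟨ recurrent-forward rec-f (+ n) ⟩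
        p * f (+ 1 ℤ.+ + n) - q * f (+ n) ≈⟨ +-cong (*-congˡ fn+1≈gn+1) (-‿cong (*-congˡ fn≈gn)) ⟩
        p * g (+ 1 ℤ.+ + n) - q * g (+ n) ≈⟨ recurrent-forward rec-g (+ n) ⟨
        g (+ 2 ℤ.+ + n)                   ∎)
      two-plus-neg : ∀ n → + 2 ℤ.+ -[1+ suc n ] ≡ + 1 ℤ.+ -[1+ n ]
      two-plus-neg zero    = ≡.refl
      two-plus-neg (suc n) = ≡.refl
      behind : ∀ n → f -[1+ n ] ≈ g -[1+ n ] × f (+ 1 ℤ.+ -[1+ n ]) ≈ g (+ 1 ℤ.+ -[1+ n ])
      behind zero = trans (recurrent-backward rec-f -[1+ 0 ])
                    (trans (*-congˡ (+-cong (*-congˡ f0≈g0) (-‿cong f1≈g1))) (sym (recurrent-backward rec-g -[1+ 0 ])))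
                  , f0≈g0
      behind (suc n) with behind n
      ... | f-n≈g-n , f1-n≈g1-n = (begin
        f -[1+ suc n ]                                          ≈⟨ recurrent-backward rec-f -[1+ suc n ] ⟩
        qinv * (p * f -[1+ n ] - f (+ 2 ℤ.+ -[1+ suc n ]))      ≡⟨ ≡.cong (λ i → qinv * (p * f -[1+ n ] - f i)) (two-plus-neg n) ⟩
        qinv * (p * f -[1+ n ] - f (+ 1 ℤ.+ -[1+ n ]))          ≈⟨ *-congˡ (+-cong (*-congˡ f-n≈g-n) (-‿cong f1-n≈g1-n)) ⟩
        qinv * (p * g -[1+ n ] - g (+ 1 ℤ.+ -[1+ n ]))          ≡⟨ ≡.cong (λ i → qinv * (p * g -[1+ n ] - g i)) (two-plus-neg n) ⟨
        qinv * (p * g -[1+ n ] - g (+ 2 ℤ.+ -[1+ suc n ]))      ≈⟨ recurrent-backward rec-g -[1+ suc n ] ⟨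
        g -[1+ suc n ]                                          ∎) , f-n≈g-n
      agree : ∀ j → f j ≈ g j
      agree (+ n)    = proj₁ (ahead n)
      agree -[1+ n ] = proj₁ (behind n)

    recurrent-+ : ∀ {f g} → Recurrent f → Recurrent g → Recurrent (λ j → f j + g j)
    recurrent-+ {f} {g} rec-f rec-g j = begin
      (f (+ 2 ℤ.+ j) + g (+ 2 ℤ.+ j)) + q * (f j + g j)           ≈⟨ regroup _ _ q _ _ ⟩
      (f (+ 2 ℤ.+ j) + q * f j) + (g (+ 2 ℤ.+ j) + q * g j)       ≈⟨ +-cong (rec-f j) (rec-g j) ⟩
      p * f (+ 1 ℤ.+ j) + p * g (+ 1 ℤ.+ j)                       ≈⟨ distribˡ p _ _ ⟨
      p * (f (+ 1 ℤ.+ j) + g (+ 1 ℤ.+ j))                         ∎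
      where
      regroup : ∀ x y q u v → (x + y) + q * (u + v) ≈ (x + q * u) + (y + q * v)
      regroup = solve 5 (λ x y q u v → (x :+ y) :+ q :* (u :+ v) := (x :+ q :* u) :+ (y :+ q :* v)) refl

    recurrent-*ʳ : ∀ {f} (d : Carrier) → Recurrent f → Recurrent (λ j → f j * d)
    recurrent-*ʳ {f} d rec j = begin
      f (+ 2 ℤ.+ j) * d + q * (f j * d) ≈⟨ +-congˡ (*-assoc q (f j) d) ⟨
      f (+ 2 ℤ.+ j) * d + q * f j * d   ≈⟨ distribʳ d _ _ ⟨
      (f (+ 2 ℤ.+ j) + q * f j) * d     ≈⟨ *-congʳ (rec j) ⟩
      p * f (+ 1 ℤ.+ j) * d             ≈⟨ *-assoc p _ d ⟩
      p * (f (+ 1 ℤ.+ j) * d)           ∎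

    recurrent-shift : ∀ {f} (d : ℤ) → Recurrent f → Recurrent (λ j → f (d ℤ.+ j))
    recurrent-shift {f} d rec j = begin
      f (d ℤ.+ (+ 2 ℤ.+ j)) + q * f (d ℤ.+ j) ≈⟨ +-congʳ (reflexive-cong f (shift-comm d (+ 2) j)) ⟩
      f (+ 2 ℤ.+ (d ℤ.+ j)) + q * f (d ℤ.+ j) ≈⟨ rec (d ℤ.+ j) ⟩
      p * f (+ 1 ℤ.+ (d ℤ.+ j))               ≈⟨ *-congˡ (reflexive-cong f (shift-comm d (+ 1) j)) ⟨
      p * f (d ℤ.+ (+ 1 ℤ.+ j))               ∎
      where
      shift-comm : ∀ d i j → d ℤ.+ (i ℤ.+ j) ≡ i ℤ.+ (d ℤ.+ j)
      shift-comm = solve-∀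

    x+q[qinv[z-x]]≈z : ∀ x z → x + q * (qinv * (z - x)) ≈ z
    x+q[qinv[z-x]]≈z x z = trans (+-congˡ (q*[qinv*x]≈x (z - x))) (trans (+-comm x (z - x)) (//-rightDividesˡ x z))

    zpow-suc : ∀ s → zpow q qinv (+ 1 ℤ.+ s) ≈ q * zpow q qinv s
    zpow-suc (+ n)        = refl
    zpow-suc -[1+ zero ]  = sym (q*[qinv*x]≈x 1#)
    zpow-suc -[1+ suc n ] = sym (q*[qinv*x]≈x (qinv ^ suc n))

    module _ (a b : Carrier) where
      private
        Wp = Wpos a b p q qinv
        Wn = Wneg a b p q qinv
        W′ = W a b p q qinv

      Wpos-suc : ∀ n → Wp (suc n) ≡ (proj₂ (Wp n) , p * proj₂ (Wp n) - q * proj₁ (Wp n))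
      Wpos-suc n with Wp n
      ... | _ = ≡.refl

      Wneg-suc : ∀ n → Wn (suc n) ≡ (qinv * (p * proj₁ (Wn n) - proj₂ (Wn n)) , proj₁ (Wn n))
      Wneg-suc n with Wn n
      ... | _ = ≡.refl

      W-recurrent : Recurrent W′
      W-recurrent (+ n) = begin
        proj₁ (Wp (suc (suc n))) + q * x ≡⟨ ≡.cong (λ w → proj₁ w + q * x) (Wpos-suc (suc n)) ⟩
        proj₂ (Wp (suc n)) + q * x       ≡⟨ ≡.cong (λ w → proj₂ w + q * x) (Wpos-suc n) ⟩
        (p * y - q * x) + q * x          ≈⟨ //-rightDividesˡ (q * x) (p * y) ⟩
        p * y                            ≡⟨ ≡.cong (λ w → p * proj₁ w) (Wpos-suc n) ⟨
        p * proj₁ (Wp (suc n))           ∎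
        where
        x = proj₁ (Wp n)
        y = proj₂ (Wp n)
      W-recurrent -[1+ zero ]        = x+q[qinv[z-x]]≈z b (p * a)
      W-recurrent -[1+ suc zero ]    = x+q[qinv[z-x]]≈z a (p * W′ -[1+ 0 ])
      W-recurrent -[1+ suc (suc n) ] = begin
        W′ -[1+ n ] + q * W′ -[1+ suc (suc n) ]                        ≡⟨ ≡.cong (λ w → W′ -[1+ n ] + q * w) unfold ⟩
        W′ -[1+ n ] + q * (qinv * (p * W′ -[1+ suc n ] - W′ -[1+ n ])) ≈⟨ x+q[qinv[z-x]]≈z (W′ -[1+ n ]) (p * W′ -[1+ suc n ]) ⟩
        p * W′ -[1+ suc n ]                                            ∎
        where
        unfold : W′ -[1+ suc (suc n) ] ≡ qinv * (p * W′ -[1+ suc n ] - W′ -[1+ n ])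
        unfold = ≡.trans (≡.cong proj₁ (Wneg-suc (suc (suc n))))
                         (≡.cong (λ w → qinv * (p * W′ -[1+ suc n ] - proj₂ w)) (Wneg-suc (suc n)))

      recurrent-zpow-W : ∀ t → Recurrent (λ s → zpow q qinv s * W′ (t ℤ.- s))
      recurrent-zpow-W t s = begin
        Z (+ 2 ℤ.+ s) * W′ u + q * (Z s * W′ (t ℤ.- s))    ≈⟨ +-congʳ (*-congʳ Z2) ⟩
        q * (q * Z s) * W′ u + q * (Z s * W′ (t ℤ.- s))    ≡⟨ ≡.cong (λ i → q * (q * Z s) * W′ u + q * (Z s * W′ i)) (idx₂ t s) ⟩
        q * (q * Z s) * W′ u + q * (Z s * W′ (+ 2 ℤ.+ u))  ≈⟨ factor q (Z s) (W′ u) (W′ (+ 2 ℤ.+ u)) ⟩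
        q * Z s * (W′ (+ 2 ℤ.+ u) + q * W′ u)              ≈⟨ *-congˡ (W-recurrent u) ⟩
        q * Z s * (p * W′ (+ 1 ℤ.+ u))                     ≡⟨ ≡.cong (λ i → q * Z s * (p * W′ i)) (idx₁ t s) ⟨
        q * Z s * (p * W′ (t ℤ.- (+ 1 ℤ.+ s)))             ≈⟨ swap (q * Z s) p _ ⟩
        p * (q * Z s * W′ (t ℤ.- (+ 1 ℤ.+ s)))             ≈⟨ *-congˡ (*-congʳ (zpow-suc s)) ⟨
        p * (Z (+ 1 ℤ.+ s) * W′ (t ℤ.- (+ 1 ℤ.+ s)))       ∎
        where
        Z = zpow q qinv
        u = t ℤ.- (+ 2 ℤ.+ s)
        Z2 : Z (+ 2 ℤ.+ s) ≈ q * (q * Z s)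
        Z2 = trans (reflexive-cong Z (ℤ.+-assoc (+ 1) (+ 1) s)) (trans (zpow-suc (+ 1 ℤ.+ s)) (*-congˡ (zpow-suc s)))
        idx₂ : ∀ t s → t ℤ.- s ≡ + 2 ℤ.+ (t ℤ.- (+ 2 ℤ.+ s))
        idx₂ = solve-∀
        idx₁ : ∀ t s → t ℤ.- (+ 1 ℤ.+ s) ≡ + 1 ℤ.+ (t ℤ.- (+ 2 ℤ.+ s))
        idx₁ = solve-∀
        factor : ∀ q z w w₂ → q * (q * z) * w + q * (z * w₂) ≈ q * z * (w₂ + q * w)
        factor = solve 4 (λ q z w w₂ → q :* (q :* z) :* w :+ q :* (z :* w₂) := q :* z :* (w₂ :+ q :* w)) refl
        swap : ∀ x y z → x * (y * z) ≈ y * (x * z)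
        swap = solve 3 (λ x y z → x :* (y :* z) := y :* (x :* z)) refl

    U-recurrent : Recurrent (U p q qinv)
    U-recurrent = W-recurrent 0# 1#

    U-two : U p q qinv (+ 2) ≈ p
    U-two = trans (+-cong (*-identityʳ p) (trans (-‿cong (zeroʳ q)) ε⁻¹≈ε)) (+-identityʳ p)

    module _ (a b : Carrier) where
      private
        W′ = W a b p q qinv
        U′ = U p q qinv

      U-suc*W : ∀ t r → U′ (+ 1 ℤ.+ r) * W′ t ≈ W′ (t ℤ.+ r) + U′ r * (q * W′ (t ℤ.- + 1))
      U-suc*W t = recurrent-unique
        (recurrent-*ʳ (W′ t) (recurrent-shift (+ 1) U-recurrent))
        (recurrent-+ (recurrent-shift t (W-recurrent a b)) (recurrent-*ʳ d U-recurrent))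
        (begin
          1# * W′ t                      ≈⟨ *-identityˡ (W′ t) ⟩
          W′ t                           ≡⟨ ≡.cong W′ (ℤ.+-identityʳ t) ⟨
          W′ (t ℤ.+ + 0)                 ≈⟨ +-identityʳ _ ⟨
          W′ (t ℤ.+ + 0) + 0#            ≈⟨ +-congˡ (zeroˡ d) ⟨
          W′ (t ℤ.+ + 0) + 0# * d        ∎)
        (begin
          U′ (+ 2) * W′ t                ≈⟨ *-congʳ U-two ⟩
          p * W′ t                       ≡⟨ ≡.cong (λ i → p * W′ i) (idx₁ t) ⟩
          p * W′ (+ 1 ℤ.+ (t ℤ.- + 1))   ≈⟨ W-recurrent a b (t ℤ.- + 1) ⟨
          W′ (+ 2 ℤ.+ (t ℤ.- + 1)) + d   ≡⟨ ≡.cong (λ i → W′ i + d) (idx₂ t) ⟨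
          W′ (t ℤ.+ + 1) + d             ≈⟨ +-congˡ (*-identityˡ d) ⟨
          W′ (t ℤ.+ + 1) + 1# * d        ∎)
        where
        d = q * W′ (t ℤ.- + 1)
        idx₁ : ∀ t → t ≡ + 1 ℤ.+ (t ℤ.- + 1)
        idx₁ = solve-∀
        idx₂ : ∀ t → t ℤ.+ + 1 ≡ + 2 ℤ.+ (t ℤ.- + 1)
        idx₂ = solve-∀

      U-addition : ∀ r s t → U′ (r ℤ.+ s) * W′ t ≈ U′ s * W′ (t ℤ.+ r) + zpow q qinv s * W′ (t ℤ.- s) * U′ r
      U-addition r s t = recurrent-unique
        (recurrent-*ʳ (W′ t) (recurrent-shift r U-recurrent))
        (recurrent-+ (recurrent-*ʳ (W′ (t ℤ.+ r)) U-recurrent) (recurrent-*ʳ (U′ r) (recurrent-zpow-W a b t)))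
        (begin
          U′ (r ℤ.+ + 0) * W′ t                          ≡⟨ ≡.cong (λ i → U′ i * W′ t) (ℤ.+-identityʳ r) ⟩
          U′ r * W′ t                                    ≈⟨ *-comm (U′ r) (W′ t) ⟩
          W′ t * U′ r                                    ≈⟨ *-congʳ (*-identityˡ (W′ t)) ⟨
          1# * W′ t * U′ r                               ≡⟨ ≡.cong (λ i → 1# * W′ i * U′ r) (ℤ.+-identityʳ t) ⟨
          1# * W′ (t ℤ.- + 0) * U′ r                     ≈⟨ +-identityˡ _ ⟨
          0# + 1# * W′ (t ℤ.- + 0) * U′ r                ≈⟨ +-congʳ (zeroˡ _) ⟨
          0# * W′ (t ℤ.+ r) + 1# * W′ (t ℤ.- + 0) * U′ r ∎)
        (begin
          U′ (r ℤ.+ + 1) * W′ t                              ≡⟨ ≡.cong (λ i → U′ i * W′ t) (ℤ.+-comm r (+ 1)) ⟩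
          U′ (+ 1 ℤ.+ r) * W′ t                              ≈⟨ U-suc*W t r ⟩
          W′ (t ℤ.+ r) + U′ r * (q * W′ (t ℤ.- + 1))         ≈⟨ +-cong (*-identityˡ _) (reorder (U′ r) q (W′ (t ℤ.- + 1))) ⟨
          1# * W′ (t ℤ.+ r) + q * 1# * W′ (t ℤ.- + 1) * U′ r ∎)
        s
        where
        reorder : ∀ u q w → q * 1# * w * u ≈ u * (q * w)
        reorder = solve 3 (λ u q w → q :* con 1 :* w :* u := u :* (q :* w)) refl

    module BinomialSums (a b : Carrier) (r s : ℤ) where
      private
        W′ = W a b p q qinv
        U′ = U p q qinv
        qˢ = zpow q qinv s

      -qˢ : Carrier
      -qˢ = - qˢ

      term : (ℕ → ℤ) → Carrier → ℕ → (ℕ → ℤ) → ℕ → Carrier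
      term β u n w k = -qˢ ^ k * (fromℤ (β k) * (U′ r ^ k * (u ^ (n ∸ k) * W′ (w k))))

      leftBinom : ℤ → ℕ → ℕ → ℤ
      leftBinom m n k = binom ((m ℤ.- + n) ℤ.+ + k) k

      leftIndex : ℕ → ℤ → ℕ → ℤ
      leftIndex n t k = (r ℤ.* (+ n ℤ.- + k) ℤ.- s ℤ.* + k) ℤ.+ t

      rightIndex : ℤ → ℕ → ℤ
      rightIndex t k = t ℤ.- s ℤ.* + k

      leftSum : ℤ → ℕ → ℤ → Carrier
      leftSum m n t = sumTo n (term (leftBinom m n) (U′ s) n (leftIndex n t))

      rightSum : ℤ → ℕ → ℤ → Carrier
      rightSum c n t = sumTo n (term (binom c) (U′ (r ℤ.+ s)) n (rightIndex t))

      sumTo-term-index : ∀ β u n {w w′ : ℕ → ℤ} → (∀ k → w k ≡ w′ k) →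
                         sumTo n (term β u n w) ≈ sumTo n (term β u n w′)
      sumTo-term-index β u n w≡w′ = sumTo-cong n λ k _ →
        reflexive-cong (λ i → -qˢ ^ k * (fromℤ (β k) * (U′ r ^ k * (u ^ (n ∸ k) * W′ i)))) (w≡w′ k)

      term-zero : ∀ β u n w → β 0 ≡ + 1 → term β u n w 0 ≈ u ^ n * W′ (w 0)
      term-zero β u n w β₀≡1 rewrite β₀≡1 =
        trans (*-identityˡ _) (trans (*-cong (+-identityʳ 1#) (*-identityˡ _)) (*-identityˡ _))

      term-vanishes : ∀ β u n w k → β k ≡ + 0 → term β u n w k ≈ 0#
      term-vanishes β u n w k βₖ≡0 rewrite βₖ≡0 = trans (*-congˡ (zeroˡ _)) (zeroʳ _)

      sumTo-term-pascal : ∀ n β β′ γ u w → β′ 0 ≡ β 0 → (∀ j → β′ (suc j) ≡ β (suc j) ℤ.+ γ j) →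
        sumTo (suc n) (term β′ u (suc n) w) ≈
        sumTo (suc n) (term β u (suc n) w) + -qˢ * U′ r * sumTo n (term γ u n (λ j → w (suc j)))
      sumTo-term-pascal n β β′ γ u w β′₀≡β₀ pascal = begin
        sumTo (suc n) T′                                            ≈⟨ sumTo-suc n T′ ⟩
        T′ 0 + sumTo n (λ j → T′ (suc j))                           ≈⟨ +-cong T′₀≈T₀ (sumTo-cong n (λ j _ → split j)) ⟩
        T 0 + sumTo n (λ j → T (suc j) + κ * S j)                   ≈⟨ +-congˡ (sumTo-+ n _ _) ⟩
        T 0 + (sumTo n (λ j → T (suc j)) + sumTo n (λ j → κ * S j)) ≈⟨ +-assoc _ _ _ ⟨
        (T 0 + sumTo n (λ j → T (suc j))) + sumTo n (λ j → κ * S j) ≈⟨ +-cong (sym (sumTo-suc n T)) (sumTo-*ˡ n κ S) ⟩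
        sumTo (suc n) T + κ * sumTo n S                             ∎
        where
        T′ = term β′ u (suc n) w
        T  = term β u (suc n) w
        S  = term γ u n (λ j → w (suc j))
        κ  = -qˢ * U′ r
        T′₀≈T₀ : T′ 0 ≈ T 0
        T′₀≈T₀ = reflexive-cong (λ x → 1# * (fromℤ x * (1# * (u ^ suc n * W′ (w 0))))) β′₀≡β₀
        distribute : ∀ x xʲ b g ur urʲ z →
          x * xʲ * ((b + g) * (ur * urʲ * z)) ≈ x * xʲ * (b * (ur * urʲ * z)) + x * ur * (xʲ * (g * (urʲ * z)))
        distribute = solve 7 (λ x xʲ b g ur urʲ z →
          x :* xʲ :* ((b :+ g) :* (ur :* urʲ :* z)) := x :* xʲ :* (b :* (ur :* urʲ :* z)) :+ x :* ur :* (xʲ :* (g :* (urʲ :* z)))) refl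
        split : ∀ j → T′ (suc j) ≈ T (suc j) + κ * S j
        split j = trans (*-congˡ (*-congʳ (trans (reflexive-cong fromℤ (pascal j)) (fromℤ-+ (β (suc j)) (γ j)))))
                        (distribute -qˢ (-qˢ ^ j) _ _ (U′ r) (U′ r ^ j) _)

      leftSum-pascal : ∀ m n t → leftSum (+ 1 ℤ.+ m) (suc n) t ≈ leftSum m (suc n) t + -qˢ * U′ r * leftSum m n (t ℤ.- s)
      leftSum-pascal m n t = trans
        (sumTo-term-pascal n (leftBinom m (suc n)) (leftBinom (+ 1 ℤ.+ m) (suc n)) (leftBinom m n) (U′ s) (leftIndex (suc n) t) ≡.refl pascal)
        (+-congˡ (*-congˡ (sumTo-term-index (leftBinom m n) (U′ s) n λ k → shift-index r s t (+ n) (+ k))))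
        where
        -- Stated over N, K : ℤ; at N = + n the term + 1 ℤ.+ N is + suc n by computation.
        upper : ∀ m N J → ((+ 1 ℤ.+ m) ℤ.- (+ 1 ℤ.+ N)) ℤ.+ (+ 1 ℤ.+ J) ≡ + 1 ℤ.+ ((m ℤ.- (+ 1 ℤ.+ N)) ℤ.+ (+ 1 ℤ.+ J))
        upper = solve-∀
        lower : ∀ m N J → (m ℤ.- (+ 1 ℤ.+ N)) ℤ.+ (+ 1 ℤ.+ J) ≡ (m ℤ.- N) ℤ.+ J
        lower = solve-∀
        shift-index : ∀ r s t N K → (r ℤ.* ((+ 1 ℤ.+ N) ℤ.- (+ 1 ℤ.+ K)) ℤ.- s ℤ.* (+ 1 ℤ.+ K)) ℤ.+ t
                                    ≡ (r ℤ.* (N ℤ.- K) ℤ.- s ℤ.* K) ℤ.+ (t ℤ.- s)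
        shift-index = solve-∀
        pascal : ∀ j → leftBinom (+ 1 ℤ.+ m) (suc n) (suc j) ≡ leftBinom m (suc n) (suc j) ℤ.+ leftBinom m n j
        pascal j = ≡.trans (≡.cong (λ x → binom x (suc j)) (upper m (+ n) (+ j)))
                  (≡.trans (binom-pascal ((m ℤ.- + suc n) ℤ.+ + suc j) j)
                           (≡.cong (λ x → leftBinom m (suc n) (suc j) ℤ.+ binom x j) (lower m (+ n) (+ j))))

      rightSum-pascal : ∀ c n t → rightSum (+ 1 ℤ.+ c) (suc n) t ≈ rightSum c (suc n) t + -qˢ * U′ r * rightSum c n (t ℤ.- s)
      rightSum-pascal c n t = trans
        (sumTo-term-pascal n (binom c) (binom (+ 1 ℤ.+ c)) (binom c) V (rightIndex t) ≡.refl (binom-pascal c))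
        (+-congˡ (*-congˡ (sumTo-term-index (binom c) V n λ k → shift-index t s (+ k))))
        where
        V = U′ (r ℤ.+ s)
        shift-index : ∀ t s K → t ℤ.- s ℤ.* (+ 1 ℤ.+ K) ≡ (t ℤ.- s) ℤ.- s ℤ.* K
        shift-index = solve-∀

      leftSum-zero-suc : ∀ n t → leftSum (+ 0) (suc n) t ≈ U′ s * leftSum -[1+ 0 ] n (t ℤ.+ r)
      leftSum-zero-suc n t = begin
        sumTo n T + T (suc n)               ≈⟨ +-cong (sumTo-cong n lower-term) top-term ⟩
        sumTo n (λ k → U′ s * T₋ k) + 0#    ≈⟨ +-identityʳ _ ⟩
        sumTo n (λ k → U′ s * T₋ k)         ≈⟨ sumTo-*ˡ n (U′ s) T₋ ⟩
        U′ s * sumTo n T₋                   ∎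
        where
        T = term (leftBinom (+ 0) (suc n)) (U′ s) (suc n) (leftIndex (suc n) t)
        T₋ = term (leftBinom -[1+ 0 ] n) (U′ s) n (leftIndex n (t ℤ.+ r))
        top-upper : ∀ N → (+ 0 ℤ.- (+ 1 ℤ.+ N)) ℤ.+ (+ 1 ℤ.+ N) ≡ + 0
        top-upper = solve-∀
        top-term : T (suc n) ≈ 0#
        top-term = term-vanishes (leftBinom (+ 0) (suc n)) (U′ s) (suc n) (leftIndex (suc n) t) (suc n)
                     (≡.trans (≡.cong (λ x → binom x (suc n)) (top-upper (+ n))) (binom-zero n))
        upper : ∀ N K → (+ 0 ℤ.- (+ 1 ℤ.+ N)) ℤ.+ K ≡ (-[1+ 0 ] ℤ.- N) ℤ.+ K
        upper = solve-∀
        index : ∀ r s t N K → (r ℤ.* ((+ 1 ℤ.+ N) ℤ.- K) ℤ.- s ℤ.* K) ℤ.+ t ≡ (r ℤ.* (N ℤ.- K) ℤ.- s ℤ.* K) ℤ.+ (t ℤ.+ r)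
        index = solve-∀
        pull-out : ∀ x b y u P w → x * (b * (y * (u * P * w))) ≈ u * (x * (b * (y * (P * w))))
        pull-out = solve 6 (λ x b y u P w → x :* (b :* (y :* (u :* P :* w))) := u :* (x :* (b :* (y :* (P :* w))))) refl
        lower-term : ∀ k → k ℕ.≤ n → T k ≈ U′ s * T₋ k
        lower-term k k≤n = begin
          T k                                           ≡⟨ ≡.cong₂ (λ x e → shape (fromℤ (binom x k)) (U′ s ^ e) w)
                                                                      (upper (+ n) (+ k)) (ℕ.+-∸-assoc 1 k≤n) ⟩
          shape β₋ (U′ s * U′ s ^ (n ∸ k)) w            ≈⟨ pull-out (-qˢ ^ k) β₋ (U′ r ^ k) (U′ s) (U′ s ^ (n ∸ k)) (W′ w) ⟩
          U′ s * shape β₋ (U′ s ^ (n ∸ k)) w            ≡⟨ ≡.cong (λ i → U′ s * shape β₋ (U′ s ^ (n ∸ k)) i) (index r s t (+ n) (+ k)) ⟩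
          U′ s * T₋ k                                   ∎
          where
          β₋ = fromℤ (leftBinom -[1+ 0 ] n k)
          w = leftIndex (suc n) t k
          shape : Carrier → Carrier → ℤ → Carrier
          shape β e i = -qˢ ^ k * (β * (U′ r ^ k * (e * W′ i)))

      rightSum-zero : ∀ n t → rightSum (+ 0) n t ≈ U′ (r ℤ.+ s) ^ n * W′ t
      rightSum-zero n t = begin
        rightSum (+ 0) n t                      ≈⟨ sumTo≈head n (λ k → term-vanishes (binom (+ 0)) V n (rightIndex t) (suc k) (binom-zero k)) ⟩
        term (binom (+ 0)) V n (rightIndex t) 0 ≈⟨ term-zero (binom (+ 0)) V n (rightIndex t) ≡.refl ⟩
        V ^ n * W′ (t ℤ.- s ℤ.* + 0)            ≡⟨ ≡.cong (λ i → V ^ n * W′ i) (no-shift t s) ⟩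
        V ^ n * W′ t                            ∎
        where
        V = U′ (r ℤ.+ s)
        no-shift : ∀ t s → t ℤ.- s ℤ.* + 0 ≡ t
        no-shift = solve-∀

      -[-qˢ*x*y]≈qˢ*x*y : ∀ x y → - (-qˢ * x * y) ≈ qˢ * x * y
      -[-qˢ*x*y]≈qˢ*x*y x y = trans (-‿distribˡ-* (-qˢ * x) y) (*-congʳ (trans (-‿distribˡ-* -qˢ x) (*-congʳ (⁻¹-involutive qˢ))))

      leftSum-minus-one : ∀ n t → leftSum -[1+ 0 ] n t ≈ U′ (r ℤ.+ s) ^ n * W′ t
      leftSum-minus-one zero t = trans (term-zero (leftBinom -[1+ 0 ] 0) (U′ s) 0 (leftIndex 0 t) ≡.refl)
                                       (reflexive-cong (λ i → 1# * W′ i) (no-shift r s t))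
        where
        no-shift : ∀ r s t → (r ℤ.* (+ 0 ℤ.- + 0) ℤ.- s ℤ.* + 0) ℤ.+ t ≡ t
        no-shift = solve-∀
      leftSum-minus-one (suc n) t = begin
        leftSum -[1+ 0 ] (suc n) t                                         ≈⟨ //-rightDividesʳ (κ * L (t ℤ.- s)) _ ⟨
        leftSum -[1+ 0 ] (suc n) t + κ * L (t ℤ.- s) - κ * L (t ℤ.- s)     ≈⟨ +-congʳ (leftSum-pascal -[1+ 0 ] n t) ⟨
        leftSum (+ 0) (suc n) t - κ * L (t ℤ.- s)                          ≈⟨ +-cong (leftSum-zero-suc n t) (-[-qˢ*x*y]≈qˢ*x*y (U′ r) (L (t ℤ.- s))) ⟩
        U′ s * L (t ℤ.+ r) + qˢ * U′ r * L (t ℤ.- s)                       ≈⟨ +-cong (*-congˡ (leftSum-minus-one n (t ℤ.+ r)))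
                                                                                     (*-congˡ (leftSum-minus-one n (t ℤ.- s))) ⟩
        U′ s * (V ^ n * W′ (t ℤ.+ r)) + qˢ * U′ r * (V ^ n * W′ (t ℤ.- s)) ≈⟨ factor (U′ s) (V ^ n) (W′ (t ℤ.+ r)) qˢ (U′ r) (W′ (t ℤ.- s)) ⟩
        V ^ n * (U′ s * W′ (t ℤ.+ r) + qˢ * W′ (t ℤ.- s) * U′ r)           ≈⟨ *-congˡ (U-addition a b r s t) ⟨
        V ^ n * (V * W′ t)                                                 ≈⟨ *-assoc (V ^ n) V (W′ t) ⟨
        V ^ n * V * W′ t                                                   ≈⟨ *-congʳ (*-comm (V ^ n) V) ⟩
        V * V ^ n * W′ t                                                   ∎
        where
        V = U′ (r ℤ.+ s)
        κ = -qˢ * U′ r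
        L = leftSum -[1+ 0 ] n
        factor : ∀ u P w z v w′ → u * (P * w) + z * v * (P * w′) ≈ P * (u * w + z * w′ * v)
        factor = solve 6 (λ u P w z v w′ → u :* (P :* w) :+ z :* v :* (P :* w′) := P :* (u :* w :+ z :* w′ :* v)) refl

      leftSum≈rightSum-step : ∀ c → (∀ n t → leftSum c n t ≈ rightSum (c ℤ.+ + 1) n t) →
                              ∀ n t → leftSum (+ 1 ℤ.+ c) n t ≈ rightSum (+ 1 ℤ.+ (c ℤ.+ + 1)) n t
      leftSum≈rightSum-step c hyp zero    t = hyp zero t
      leftSum≈rightSum-step c hyp (suc n) t = begin
        leftSum (+ 1 ℤ.+ c) (suc n) t                                                   ≈⟨ leftSum-pascal c n t ⟩
        leftSum c (suc n) t + -qˢ * U′ r * leftSum c n (t ℤ.- s)                       ≈⟨ +-cong (hyp (suc n) t) (*-congˡ (hyp n (t ℤ.- s))) ⟩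
        rightSum (c ℤ.+ + 1) (suc n) t + -qˢ * U′ r * rightSum (c ℤ.+ + 1) n (t ℤ.- s) ≈⟨ rightSum-pascal (c ℤ.+ + 1) n t ⟨
        rightSum (+ 1 ℤ.+ (c ℤ.+ + 1)) (suc n) t                                        ∎

      leftSum≈rightSum : ∀ m n t → leftSum (+ m) n t ≈ rightSum (+ m ℤ.+ + 1) n t
      leftSum≈rightSum zero    = leftSum≈rightSum-step -[1+ 0 ] λ n t →
                                   trans (leftSum-minus-one n t) (sym (rightSum-zero n t))
      leftSum≈rightSum (suc m) = leftSum≈rightSum-step (+ m) (leftSum≈rightSum m)

open import Data.Integer using (ℤ; +_; _+_; _-_; _*_)

theorem5 : {c ℓ : Level} (R : CommutativeRing c ℓ) (a b p q qinv : CommutativeRing.Carrier R) →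
  ¬ CommutativeRing._≈_ R p (CommutativeRing.0# R) →
  ¬ CommutativeRing._≈_ R q (CommutativeRing.0# R) →
  CommutativeRing._≈_ R (CommutativeRing._*_ R q qinv) (CommutativeRing.1# R) →
  (m n : ℕ) (r s t : ℤ) →
  CommutativeRing._≈_ R
    (Horadam.sumTo R n (λ k →
      CommutativeRing._*_ R (Horadam._^_ R (CommutativeRing.-_ R (Horadam.zpow R q qinv s)) k)
      (CommutativeRing._*_ R (Horadam.fromℤ R (binom ((+ m - + n) + + k) k))
      (CommutativeRing._*_ R (Horadam._^_ R (Horadam.U R p q qinv r) k)
      (CommutativeRing._*_ R (Horadam._^_ R (Horadam.U R p q qinv s) (n Data.Nat.∸ k))
        (Horadam.W R a b p q qinv ((r * (+ n - + k) - s * + k) + t)))))))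
    (Horadam.sumTo R n (λ k →
      CommutativeRing._*_ R (Horadam._^_ R (CommutativeRing.-_ R (Horadam.zpow R q qinv s)) k)
      (CommutativeRing._*_ R (Horadam.fromℤ R (binom (+ m + + 1) k))
      (CommutativeRing._*_ R (Horadam._^_ R (Horadam.U R p q qinv r) k)
      (CommutativeRing._*_ R (Horadam._^_ R (Horadam.U R p q qinv (r + s)) (n Data.Nat.∸ k))
        (Horadam.W R a b p q qinv (t - s * + k)))))))
theorem5 R a b p q qinv _ _ q*qinv≈1 m n r s t = leftSum≈rightSum m n t
  where
  open HoradamIdentities.Recurrence R p q qinv q*qinv≈1
  open BinomialSums a b r s
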